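{- Let $\mathbb{F}$ be a field and let ROD denote the set of polynomials over $\mathbb{F}$ that equal $\det(M)$ for some matrix $M$ whose entries are variables or field elements, in which each variable occurs in at most one position. Then: (1) if $S_m^k\notin ROD$, then $S_n^d\notin ROD$ for all $d\ge k$ and $n\ge m+d-k$; (2) if $Perm_m\notin ROD$, then $Perm_n\notin ROD$ for all $n\ge m$.
   Context: $S_n^d(x_1,\ldots,x_n)=\sum_{A\subseteq\{1,\ldots,n\},|A|=d}\prod_{i\in A}x_i$ is the elementary symmetric polynomial of degree $d$ in $n$ variables. $Perm_n(x_{11},\ldots,x_{nn})=\sum_{\sigma\in S_n}\prod_{i=1}^n x_{i,\sigma(i)}$ is the $n\times n$ permanent in $n^2$ variables. -}

module Defs where

open import Level using (Level; _⊔_)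
open import Algebra.Bundles using (CommutativeRing)
open import Data.Nat as ℕ using (ℕ; zero; suc)
open import Data.Fin as Fin using (Fin; zero; suc)
open import Data.Fin.Subset using (Subset; ∣_∣; inside; outside)
open import Data.Bool using (Bool; true; false; if_then_else_; _∧_; not)
open import Data.List using (List; []; _∷_; map; concatMap; foldr; allFin)
open import Data.Vec using (Vec; []; _∷_; lookup)
open import Data.Sum using (_⊎_; inj₁; inj₂)
open import Data.Product using (_×_; Σ; ∃; ∃-syntax; _,_)
open import Relation.Nullary using (¬_; does)
open import Relation.Binary.PropositionalEquality using (_≡_)

record Field (c ℓ : Level) : Set (Level.suc (c ⊔ ℓ)) where
  field
    commutativeRing : CommutativeRing c ℓ
  open CommutativeRing commutativeRing public
  field
    1≉0     : ¬ (1# ≈ 0#)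
    inverse : ∀ x → ¬ (x ≈ 0#) → ∃[ y ] (x * y ≈ 1#)

-- The polynomial ring F[V] in variables from a type V, constructed as
-- the free commutative F-algebra on V: polynomial expressions modulo the
-- smallest congruence containing the commutative-ring axioms and making
-- constants a ring homomorphism F → F[V].

module Poly {c ℓ : Level} (F : Field c ℓ) where
  private module F = Field F

  data Pol {v} (V : Set v) : Set (c ⊔ v) where
    var  : V → Pol V
    con  : F.Carrier → Pol V
    _⊕_  : Pol V → Pol V → Pol V
    _⊗_  : Pol V → Pol V → Pol V

  infixl 6 _⊕_
  infixl 7 _⊗_
  infix 4 _≋_

  data _≋_ {v} {V : Set v} : Pol V → Pol V → Set (c ⊔ ℓ ⊔ v) where
    ≋-refl  : ∀ {p} → p ≋ p
    ≋-sym   : ∀ {p q} → p ≋ q → q ≋ p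
    ≋-trans : ∀ {p q r} → p ≋ q → q ≋ r → p ≋ r
    ⊕-cong  : ∀ {p p′ q q′} → p ≋ p′ → q ≋ q′ → p ⊕ q ≋ p′ ⊕ q′
    ⊗-cong  : ∀ {p p′ q q′} → p ≋ p′ → q ≋ q′ → p ⊗ q ≋ p′ ⊗ q′
    ⊕-assoc : ∀ p q r → (p ⊕ q) ⊕ r ≋ p ⊕ (q ⊕ r)
    ⊕-comm  : ∀ p q → p ⊕ q ≋ q ⊕ p
    ⊕-idˡ   : ∀ p → con F.0# ⊕ p ≋ p
    ⊕-invʳ  : ∀ p → p ⊕ (con (F.- F.1#) ⊗ p) ≋ con F.0#
    ⊗-assoc : ∀ p q r → (p ⊗ q) ⊗ r ≋ p ⊗ (q ⊗ r)
    ⊗-comm  : ∀ p q → p ⊗ q ≋ q ⊗ p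
    ⊗-idˡ   : ∀ p → con F.1# ⊗ p ≋ p
    distribˡ : ∀ p q r → p ⊗ (q ⊕ r) ≋ (p ⊗ q) ⊕ (p ⊗ r)
    con-cong : ∀ {a b} → a F.≈ b → con a ≋ con b
    con-+   : ∀ a b → con a ⊕ con b ≋ con (a F.+ b)
    con-*   : ∀ a b → con a ⊗ con b ≋ con (a F.* b)

  Σ[_] : ∀ {v} {V : Set v} → List (Pol V) → Pol V
  Σ[ ps ] = foldr _⊕_ (con F.0#) ps

  Π[_] : ∀ {v} {V : Set v} → List (Pol V) → Pol V
  Π[ ps ] = foldr _⊗_ (con F.1#) ps

  allSubsets : ∀ n → List (Subset n)
  allSubsets zero    = [] ∷ []
  allSubsets (suc n) = concatMap (λ s → (outside ∷ s) ∷ (inside ∷ s) ∷ []) (allSubsets n)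

  allFuns : ∀ m n → List (Fin m → Fin n)
  allFuns zero    n = (λ ()) ∷ []
  allFuns (suc m) n =
    concatMap (λ f → map (λ a → λ { zero → a ; (suc i) → f i }) (allFin n)) (allFuns m n)

  pairs : ∀ n → List (Fin n × Fin n)
  pairs n = concatMap (λ i → concatMap (λ j → if does (i Fin.<? j) then (i , j) ∷ [] else [])
                                        (allFin n))
                      (allFin n)

  -- σ is injective (hence a permutation of Fin n)
  isPerm : ∀ {n} → (Fin n → Fin n) → Bool
  isPerm {n} σ = foldr (λ { (i , j) b → not (does (σ i Fin.≟ σ j)) ∧ b }) true (pairs n)

  perms : ∀ n → List (Fin n → Fin n)
  perms n = Data.List.filterᵇ isPerm (allFuns n n)
    where import Data.List

  inversions : ∀ {n} → (Fin n → Fin n) → ℕ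
  inversions {n} σ =
    foldr (λ { (i , j) k → if does (σ j Fin.<? σ i) then suc k else k }) zero (pairs n)

  sgn : ∀ {n} → (Fin n → Fin n) → F.Carrier
  sgn σ = go (inversions σ)
    where go : ℕ → F.Carrier
          go zero    = F.1#
          go (suc k) = F.- (go k)

  det : ∀ {v} {V : Set v} {k} → (Fin k → Fin k → Pol V) → Pol V
  det {k = k} M =
    Σ[ map (λ σ → con (sgn σ) ⊗ Π[ map (λ i → M i (σ i)) (allFin k) ]) (perms k) ]

  Entry : ∀ {v} → Set v → Set (c ⊔ v)
  Entry V = V ⊎ F.Carrier

  toPol : ∀ {v} {V : Set v} → Entry V → Pol V
  toPol (inj₁ x) = var x
  toPol (inj₂ a) = con a

  ReadOnce : ∀ {v} {V : Set v} {k} → (Fin k → Fin k → Entry V) → Set (c ⊔ v)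
  ReadOnce {V = V} {k} M =
    ∀ (x : V) (i j i′ j′ : Fin k) → M i j ≡ inj₁ x → M i′ j′ ≡ inj₁ x → (i ≡ i′ × j ≡ j′)

  ROD : ∀ {v} {V : Set v} → Pol V → Set (c ⊔ ℓ ⊔ v)
  ROD {V = V} f =
    ∃[ k ] Σ (Fin k → Fin k → Entry V) λ M → ReadOnce M × (det (λ i j → toPol (M i j)) ≋ f)

  S : ∀ n d → Pol (Fin n)
  S n d = Σ[ map (λ A → Π[ map (λ i → if lookup A i then var i else con F.1#) (allFin n) ])
                 (Data.List.filterᵇ (λ A → does (∣ A ∣ ℕ.≟ d)) (allSubsets n)) ]
    where import Data.List

  Perm : ∀ n → Pol (Fin n × Fin n)
  Perm n = Σ[ map (λ σ → Π[ map (λ i → var (i , σ i)) (allFin n) ]) (perms n) ]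

-- ROD is closed under ≋, under read-once substitutions (distinct variables go
-- to distinct variables, the others to constants) and under ∂/∂x: if x sits at
-- position (i, j) of a read-once matrix M, expanding along row i gives
-- det M = x · det M′ + det M″ with M′, M″ free of x, where M′ is M with row i
-- replaced by the j-th unit row.  Setting x₀ = 0 turns S_{n+1}^d into S_n^d; by
-- the Pascal recurrence S_{n+1}^{d+1} = x₀ S_n^d + S_n^{d+1}, differentiating in
-- x₀ and then setting x₀ = 0 turns it into S_n^d; and x₀₀ ↦ 1, x₀ⱼ, xᵢ₀ ↦ 0
-- turns Perm_{n+1} into Perm_n.
module Submission where

open import Level using (Level; _⊔_)
open import Algebra.Bundles using (CommutativeRing)
import Algebra.Solver.Ring.NaturalCoefficients.Default as NaturalCoefficientsSolver
open import Data.Empty using (⊥-elim)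
open import Data.Bool using (Bool; true; false; if_then_else_; _∧_; not)
open import Data.Fin as Fin using (Fin; zero; suc)
import Data.Fin.Properties as Finₚ
open import Data.Fin.Subset using (Subset; ∣_∣; inside; outside)
open import Data.List using (List; []; _∷_; [_]; _++_; map; concat; concatMap; foldr; filterᵇ; allFin)
import Data.List.Properties as Listₚ
open import Data.Nat as ℕ using (ℕ; zero; suc; _≤_; _≤′_; ≤′-refl; ≤′-step; _+_; _∸_)
import Data.Nat.Properties as ℕₚ
open import Data.Product using (_×_; _,_; proj₁; proj₂)
open import Data.Sum using (inj₁; inj₂; [_,_]′)
open import Data.Vec using (_∷_; lookup)
open import Data.Vec.Functional using () renaming (_∷_ to _◂_)
open import Function using (_∘_; id)
open import Relation.Binary.Definitions using (DecidableEquality)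
import Relation.Binary.Reasoning.Setoid as SetoidReasoning
open import Relation.Binary.PropositionalEquality as ≡ using (_≡_; _≢_; refl; _≗_)
open import Relation.Nullary using (¬_; Dec; yes; no; does)
open import Relation.Nullary.Decidable using (dec-true; dec-false)

open import Defs

private
  variable
    a b v w : Level
    A : Set a
    B : Set b
    k m n N : ℕ

map-allFin-suc : (f : Fin (suc n) → A) → map f (allFin (suc n)) ≡ f zero ∷ map (f ∘ suc) (allFin n)
map-allFin-suc f =
  ≡.cong (f zero ∷_) (≡.trans (Listₚ.map-tabulate Fin.suc f) (≡.sym (Listₚ.map-tabulate id (f ∘ suc))))

concatMap-allFin-suc : (f : Fin (suc n) → List A) →
  concatMap f (allFin (suc n)) ≡ f zero ++ concatMap (f ∘ suc) (allFin n)
concatMap-allFin-suc f = ≡.cong concat (map-allFin-suc f)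

concatMap-singleton : (f : A → B) (xs : List A) → concatMap (λ x → [ f x ]) xs ≡ map f xs
concatMap-singleton f xs = ≡.trans (≡.sym (Listₚ.concatMap-map [_] f xs)) (Listₚ.concatMap-pure (map f xs))

module _ {c ℓ} (F : Field c ℓ) where
  open Poly F
  private module F = Field F

  polyRing : (V : Set v) → CommutativeRing (c ⊔ v) (c ⊔ ℓ ⊔ v)
  polyRing V = record
    { Carrier = Pol V ; _≈_ = _≋_ ; _+_ = _⊕_ ; _*_ = _⊗_
    ; -_ = con (F.- F.1#) ⊗_ ; 0# = con F.0# ; 1# = con F.1#
    ; isCommutativeRing = record
      { isRing = record
        { +-isAbelianGroup = record
          { isGroup = record
            { isMonoid = record
              { isSemigroup = record
                { isMagma = record
                  { isEquivalence = record { refl = ≋-refl ; sym = ≋-sym ; trans = ≋-trans }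
                  ; ∙-cong = ⊕-cong }
                ; assoc = ⊕-assoc }
              ; identity = ⊕-idˡ , λ p → ≋-trans (⊕-comm p _) (⊕-idˡ p) }
            ; inverse = (λ p → ≋-trans (⊕-comm _ p) (⊕-invʳ p)) , ⊕-invʳ
            ; ⁻¹-cong = ⊗-cong ≋-refl }
          ; comm = ⊕-comm }
        ; *-cong = ⊗-cong
        ; *-assoc = ⊗-assoc
        ; *-identity = ⊗-idˡ , λ p → ≋-trans (⊗-comm p _) (⊗-idˡ p)
        ; distrib = distribˡ , λ p q r →
            ≋-trans (⊗-comm _ p) (≋-trans (distribˡ p q r) (⊕-cong (⊗-comm p q) (⊗-comm p r))) }
      ; *-comm = ⊗-comm } }

  module PolySolver {v} (V : Set v) =
    NaturalCoefficientsSolver (CommutativeRing.commutativeSemiring (polyRing V))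

  0ₚ 1ₚ : {V : Set v} → Pol V
  0ₚ = con F.0#
  1ₚ = con F.1#

  module _ {v} {V : Set v} where
    open CommutativeRing (polyRing V) public
      using () renaming (zeroˡ to ⊗-zeroˡ; zeroʳ to ⊗-zeroʳ; +-identityʳ to ⊕-idʳ; *-identityʳ to ⊗-idʳ)

    module ≋-Reasoning = SetoidReasoning (CommutativeRing.setoid (polyRing V))

    ≡⇒≋ : {p q : Pol V} → p ≡ q → p ≋ q
    ≡⇒≋ refl = ≋-refl

    if-cong : (b : Bool) {p q r : Pol V} → p ≋ q → (if b then p else r) ≋ (if b then q else r)
    if-cong true  p≋q = p≋q
    if-cong false _   = ≋-refl

    if-zero : (b : Bool) {p : Pol V} → p ≋ 0ₚ → (if b then p else 0ₚ) ≋ 0ₚ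
    if-zero true  p≋0 = p≋0
    if-zero false _   = ≋-refl

  module _ {v} {V : Set v} where
    open PolySolver V using (solve; _:=_; _:+_; _:*_)
    open ≋-Reasoning

    Σ-++ : (ps qs : List (Pol V)) → Σ[ ps ++ qs ] ≋ Σ[ ps ] ⊕ Σ[ qs ]
    Σ-++ []       qs = ≋-sym (⊕-idˡ _)
    Σ-++ (p ∷ ps) qs = ≋-trans (⊕-cong ≋-refl (Σ-++ ps qs)) (≋-sym (⊕-assoc _ _ _))

    Σ-map-cong : {f g : A → Pol V} → (∀ x → f x ≋ g x) → ∀ xs → Σ[ map f xs ] ≋ Σ[ map g xs ]
    Σ-map-cong f≋g []       = ≋-refl
    Σ-map-cong f≋g (x ∷ xs) = ⊕-cong (f≋g x) (Σ-map-cong f≋g xs)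

    Σ-map-zero : {f : A → Pol V} → (∀ x → f x ≋ 0ₚ) → ∀ xs → Σ[ map f xs ] ≋ 0ₚ
    Σ-map-zero f≋0 []       = ≋-refl
    Σ-map-zero f≋0 (x ∷ xs) = ≋-trans (⊕-cong (f≋0 x) (Σ-map-zero f≋0 xs)) (⊕-idˡ _)

    Σ-map-concatMap : (f : B → Pol V) (g : A → List B) (xs : List A) →
      Σ[ map f (concatMap g xs) ] ≋ Σ[ map (λ x → Σ[ map f (g x) ]) xs ]
    Σ-map-concatMap f g []       = ≋-refl
    Σ-map-concatMap f g (x ∷ xs) = begin
      Σ[ map f (g x ++ concatMap g xs) ]            ≡⟨ ≡.cong Σ[_] (Listₚ.map-++ f (g x) _) ⟩
      Σ[ map f (g x) ++ map f (concatMap g xs) ]    ≈⟨ Σ-++ (map f (g x)) _ ⟩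
      Σ[ map f (g x) ] ⊕ Σ[ map f (concatMap g xs) ] ≈⟨ ⊕-cong ≋-refl (Σ-map-concatMap f g xs) ⟩
      Σ[ map (λ x → Σ[ map f (g x) ]) (x ∷ xs) ]    ∎

    Σ-map-filterᵇ : (q : A → Bool) (f : A → Pol V) (xs : List A) →
      Σ[ map f (filterᵇ q xs) ] ≋ Σ[ map (λ x → if q x then f x else 0ₚ) xs ]
    Σ-map-filterᵇ q f []       = ≋-refl
    Σ-map-filterᵇ q f (x ∷ xs) with q x
    ... | true  = ⊕-cong ≋-refl (Σ-map-filterᵇ q f xs)
    ... | false = ≋-trans (Σ-map-filterᵇ q f xs) (≋-sym (⊕-idˡ _))

    Σ-map-linear : {f g h : A → Pol V} (p : Pol V) → (∀ x → f x ≋ p ⊗ g x ⊕ h x) →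
      ∀ xs → Σ[ map f xs ] ≋ p ⊗ Σ[ map g xs ] ⊕ Σ[ map h xs ]
    Σ-map-linear p f≋ [] = ≋-sym (≋-trans (⊕-cong (⊗-zeroʳ p) ≋-refl) (⊕-idˡ _))
    Σ-map-linear {g = g} {h} p f≋ (x ∷ xs) =
      ≋-trans (⊕-cong (f≋ x) (Σ-map-linear p f≋ xs))
        (solve 5 (λ p g h G H → ((p :* g) :+ h) :+ ((p :* G) :+ H) := (p :* (g :+ G)) :+ (h :+ H))
          ≋-refl p (g x) (h x) Σ[ map g xs ] Σ[ map h xs ])

    Π-map-cong : {f g : A → Pol V} → (∀ x → f x ≋ g x) → ∀ xs → Π[ map f xs ] ≋ Π[ map g xs ]
    Π-map-cong f≋g []       = ≋-refl
    Π-map-cong f≋g (x ∷ xs) = ⊗-cong (f≋g x) (Π-map-cong f≋g xs)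

    Π-allFin-suc : (f : Fin (suc k) → Pol V) → Π[ map f (allFin (suc k)) ] ≡ f zero ⊗ Π[ map (f ∘ suc) (allFin k) ]
    Π-allFin-suc f = ≡.cong Π[_] (map-allFin-suc f)

    Π-allFin-zero : (f : Fin k → Pol V) (i : Fin k) → f i ≋ 0ₚ → Π[ map f (allFin k) ] ≋ 0ₚ
    Π-allFin-zero f zero    fi≋0 = begin
      Π[ map f (allFin _) ]                   ≡⟨ Π-allFin-suc f ⟩
      f zero ⊗ Π[ map (f ∘ suc) (allFin _) ]  ≈⟨ ⊗-cong fi≋0 ≋-refl ⟩
      0ₚ ⊗ Π[ map (f ∘ suc) (allFin _) ]      ≈⟨ ⊗-zeroˡ _ ⟩
      0ₚ                                      ∎
    Π-allFin-zero f (suc i) fi≋0 = begin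
      Π[ map f (allFin _) ]                   ≡⟨ Π-allFin-suc f ⟩
      f zero ⊗ Π[ map (f ∘ suc) (allFin _) ]  ≈⟨ ⊗-cong ≋-refl (Π-allFin-zero (f ∘ suc) i fi≋0) ⟩
      f zero ⊗ 0ₚ                             ≈⟨ ⊗-zeroʳ _ ⟩
      0ₚ                                      ∎

    Π-allFin-linear : (p : Pol V) (f g h : Fin k → Pol V) (i : Fin k) → f i ≋ p ⊗ g i ⊕ h i →
      (∀ r → r ≢ i → g r ≋ f r × h r ≋ f r) →
      Π[ map f (allFin k) ] ≋ p ⊗ Π[ map g (allFin k) ] ⊕ Π[ map h (allFin k) ]
    Π-allFin-linear {k = suc k} p f g h zero fi≋ others = begin
      Π[ map f (allFin (suc k)) ]                  ≡⟨ Π-allFin-suc f ⟩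
      f zero ⊗ Πf′                                 ≈⟨ ⊗-cong fi≋ ≋-refl ⟩
      (p ⊗ g zero ⊕ h zero) ⊗ Πf′
        ≈⟨ solve 4 (λ p g h Π → ((p :* g) :+ h) :* Π := (p :* (g :* Π)) :+ (h :* Π)) ≋-refl p (g zero) (h zero) Πf′ ⟩
      p ⊗ (g zero ⊗ Πf′) ⊕ h zero ⊗ Πf′
        ≈⟨ ⊕-cong (⊗-cong ≋-refl (⊗-cong ≋-refl (Π-map-cong (λ r → ≋-sym (proj₁ (others (suc r) λ ()))) (allFin k))))
                  (⊗-cong ≋-refl (Π-map-cong (λ r → ≋-sym (proj₂ (others (suc r) λ ()))) (allFin k))) ⟩
      p ⊗ (g zero ⊗ Π[ map (g ∘ suc) (allFin k) ]) ⊕ h zero ⊗ Π[ map (h ∘ suc) (allFin k) ]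
        ≡⟨ ≡.sym (≡.cong₂ (λ G H → p ⊗ G ⊕ H) (Π-allFin-suc g) (Π-allFin-suc h)) ⟩
      p ⊗ Π[ map g (allFin (suc k)) ] ⊕ Π[ map h (allFin (suc k)) ] ∎
      where Πf′ = Π[ map (f ∘ suc) (allFin k) ]
    Π-allFin-linear {k = suc k} p f g h (suc i) fi≋ others = begin
      Π[ map f (allFin (suc k)) ]  ≡⟨ Π-allFin-suc f ⟩
      f zero ⊗ Π[ map (f ∘ suc) (allFin k) ]
        ≈⟨ ⊗-cong ≋-refl (Π-allFin-linear p (f ∘ suc) (g ∘ suc) (h ∘ suc) i fi≋
                            (λ r r≢i → others (suc r) (r≢i ∘ Finₚ.suc-injective))) ⟩
      f zero ⊗ (p ⊗ Πg′ ⊕ Πh′)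
        ≈⟨ solve 4 (λ f p G H → f :* ((p :* G) :+ H) := (p :* (f :* G)) :+ (f :* H)) ≋-refl (f zero) p Πg′ Πh′ ⟩
      p ⊗ (f zero ⊗ Πg′) ⊕ f zero ⊗ Πh′
        ≈⟨ ⊕-cong (⊗-cong ≋-refl (⊗-cong (≋-sym (proj₁ (others zero λ ()))) ≋-refl))
                  (⊗-cong (≋-sym (proj₂ (others zero λ ()))) ≋-refl) ⟩
      p ⊗ (g zero ⊗ Πg′) ⊕ h zero ⊗ Πh′
        ≡⟨ ≡.sym (≡.cong₂ (λ G H → p ⊗ G ⊕ H) (Π-allFin-suc g) (Π-allFin-suc h)) ⟩
      p ⊗ Π[ map g (allFin (suc k)) ] ⊕ Π[ map h (allFin (suc k)) ] ∎
      where Πg′ = Π[ map (g ∘ suc) (allFin k) ]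
            Πh′ = Π[ map (h ∘ suc) (allFin k) ]

  Matrix : Set a → ℕ → Set a
  Matrix A k = Fin k → Fin k → A

  polMatrix : {V : Set v} → Matrix (Entry V) k → Matrix (Pol V) k
  polMatrix M i j = toPol (M i j)

  entriesAlong : {V : Set v} → Matrix (Pol V) k → (Fin k → Fin k) → Pol V
  entriesAlong {k = k} M σ = Π[ map (λ i → M i (σ i)) (allFin k) ]

  module _ {v} {V : Set v} where
    open PolySolver V using (solve; _:=_; _:+_; _:*_)

    det-cong : {M N : Matrix (Pol V) k} → (∀ i j → M i j ≋ N i j) → det M ≋ det N
    det-cong {k = k} M≋N =
      Σ-map-cong (λ σ → ⊗-cong ≋-refl (Π-map-cong (λ i → M≋N i (σ i)) (allFin k))) (perms k)

    det-zero-row : (M : Matrix (Pol V) k) (i : Fin k) → (∀ j → M i j ≋ 0ₚ) → det M ≋ 0ₚ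
    det-zero-row {k = k} M i Mi≋0 =
      Σ-map-zero (λ σ → ≋-trans (⊗-cong ≋-refl (Π-allFin-zero _ i (Mi≋0 (σ i)))) (⊗-zeroʳ _)) (perms k)

    det-linear-row : (p : Pol V) (M N N′ : Matrix (Pol V) k) (i : Fin k) →
      (∀ j → M i j ≋ p ⊗ N i j ⊕ N′ i j) →
      (∀ r → r ≢ i → ∀ j → N r j ≋ M r j × N′ r j ≋ M r j) →
      det M ≋ p ⊗ det N ⊕ det N′
    det-linear-row {k = k} p M N N′ i row others = Σ-map-linear p expand (perms k)
      where
      open ≋-Reasoning
      expand : ∀ σ → con (sgn σ) ⊗ entriesAlong M σ ≋ p ⊗ (con (sgn σ) ⊗ entriesAlong N σ) ⊕ con (sgn σ) ⊗ entriesAlong N′ σ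
      expand σ = begin
        con (sgn σ) ⊗ entriesAlong M σ
          ≈⟨ ⊗-cong ≋-refl (Π-allFin-linear p _ _ _ i (row (σ i)) (λ r r≢i → others r r≢i (σ r))) ⟩
        con (sgn σ) ⊗ (p ⊗ entriesAlong N σ ⊕ entriesAlong N′ σ)
          ≈⟨ solve 4 (λ s p x y → s :* ((p :* x) :+ y) := (p :* (s :* x)) :+ (s :* y)) ≋-refl _ p _ _ ⟩
        p ⊗ (con (sgn σ) ⊗ entriesAlong N σ) ⊕ con (sgn σ) ⊗ entriesAlong N′ σ ∎

  -- Read-once substitutions

  sub : {V : Set v} {W : Set w} → (V → Entry W) → Pol V → Pol W
  sub θ (var x) = toPol (θ x)
  sub θ (con a) = con a
  sub θ (p ⊕ q) = sub θ p ⊕ sub θ q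
  sub θ (p ⊗ q) = sub θ p ⊗ sub θ q

  VarInjective : {V : Set v} {W : Set w} → (V → Entry W) → Set (c ⊔ v ⊔ w)
  VarInjective θ = ∀ {x y z} → θ x ≡ inj₁ z → θ y ≡ inj₁ z → x ≡ y

  module _ {v w} {V : Set v} {W : Set w} (θ : V → Entry W) where
    sub-cong : {p q : Pol V} → p ≋ q → sub θ p ≋ sub θ q
    sub-cong ≋-refl             = ≋-refl
    sub-cong (≋-sym e)          = ≋-sym (sub-cong e)
    sub-cong (≋-trans e e′)     = ≋-trans (sub-cong e) (sub-cong e′)
    sub-cong (⊕-cong e e′)      = ⊕-cong (sub-cong e) (sub-cong e′)
    sub-cong (⊗-cong e e′)      = ⊗-cong (sub-cong e) (sub-cong e′)
    sub-cong (⊕-assoc p q r)    = ⊕-assoc _ _ _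
    sub-cong (⊕-comm p q)       = ⊕-comm _ _
    sub-cong (⊕-idˡ p)          = ⊕-idˡ _
    sub-cong (⊕-invʳ p)         = ⊕-invʳ _
    sub-cong (⊗-assoc p q r)    = ⊗-assoc _ _ _
    sub-cong (⊗-comm p q)       = ⊗-comm _ _
    sub-cong (⊗-idˡ p)          = ⊗-idˡ _
    sub-cong (distribˡ p q r)   = distribˡ _ _ _
    sub-cong (con-cong a≈b)     = con-cong a≈b
    sub-cong (con-+ a b)        = con-+ a b
    sub-cong (con-* a b)        = con-* a b

    sub-Σ-map : (f : A → Pol V) (xs : List A) → sub θ Σ[ map f xs ] ≡ Σ[ map (sub θ ∘ f) xs ]
    sub-Σ-map f []       = refl
    sub-Σ-map f (x ∷ xs) = ≡.cong (sub θ (f x) ⊕_) (sub-Σ-map f xs)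

    sub-Π-map : (f : A → Pol V) (xs : List A) → sub θ Π[ map f xs ] ≡ Π[ map (sub θ ∘ f) xs ]
    sub-Π-map f []       = refl
    sub-Π-map f (x ∷ xs) = ≡.cong (sub θ (f x) ⊗_) (sub-Π-map f xs)

    sub-toPol : (e : Entry V) → sub θ (toPol e) ≡ toPol ([ θ , inj₂ ]′ e)
    sub-toPol (inj₁ x) = refl
    sub-toPol (inj₂ a) = refl

    sub-det : (M : Matrix (Pol V) k) → sub θ (det M) ≡ det (λ i j → sub θ (M i j))
    sub-det {k = k} M = ≡.trans (sub-Σ-map _ (perms k)) (≡.cong Σ[_] (Listₚ.map-cong sub-term (perms k)))
      where
      sub-term : ∀ σ → sub θ (con (sgn σ) ⊗ entriesAlong M σ) ≡ con (sgn σ) ⊗ entriesAlong (λ i j → sub θ (M i j)) σ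
      sub-term σ = ≡.cong (con (sgn σ) ⊗_) (sub-Π-map _ (allFin k))

  module _ {v} {V : Set v} where
    ROD-resp-≋ : {f g : Pol V} → f ≋ g → ROD f → ROD g
    ROD-resp-≋ f≋g (k , M , readOnce , det≋f) = k , M , readOnce , ≋-trans det≋f f≋g

    ROD-0ₚ : ROD {V = V} 0ₚ
    ROD-0ₚ = 1 , (λ _ _ → inj₂ F.0#) , (λ _ _ _ _ _ ()) ,
             det-zero-row {k = 1} (λ _ _ → toPol {V = V} (inj₂ F.0#)) zero (λ _ → ≋-refl)

  ROD-sub : {V : Set v} {W : Set w} {f : Pol V} (θ : V → Entry W) → VarInjective θ → ROD f → ROD (sub θ f)
  ROD-sub {V = V} {W} {f} θ θ-injective (k , M , readOnce , det≋f) = k , θM , θM-readOnce , det-θM≋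
    where
    θM : Matrix (Entry W) k
    θM i j = [ θ , inj₂ ]′ (M i j)

    θM-readOnce : ReadOnce θM
    θM-readOnce z i j i′ j′ e e′ with M i j in eq | M i′ j′ in eq′
    θM-readOnce z i j i′ j′ e  e′ | inj₁ x | inj₁ y with refl ← θ-injective e e′ = readOnce x i j i′ j′ eq eq′
    θM-readOnce z i j i′ j′ () e′ | inj₂ _ | _
    θM-readOnce z i j i′ j′ e  () | inj₁ _ | inj₂ _

    det-θM≋ : det (polMatrix θM) ≋ sub θ f
    det-θM≋ = ≋-trans (det-cong (λ i j → ≡⇒≋ (≡.sym (sub-toPol θ (M i j)))))
                      (≋-trans (≡⇒≋ (≡.sym (sub-det θ (polMatrix M)))) (sub-cong θ det≋f))

  -- Partial derivatives

  module Derivative {v} {V : Set v} (_≟_ : DecidableEquality V) (x : V) where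
    open PolySolver V using (solve; _:=_; _:+_; _:*_)

    ∂ : Pol V → Pol V
    ∂ (var y) = if does (y ≟ x) then 1ₚ else 0ₚ
    ∂ (con _) = 0ₚ
    ∂ (p ⊕ q) = ∂ p ⊕ ∂ q
    ∂ (p ⊗ q) = ∂ p ⊗ q ⊕ p ⊗ ∂ q

    ∂-cong : {p q : Pol V} → p ≋ q → ∂ p ≋ ∂ q
    ∂-cong ≋-refl           = ≋-refl
    ∂-cong (≋-sym e)        = ≋-sym (∂-cong e)
    ∂-cong (≋-trans e e′)   = ≋-trans (∂-cong e) (∂-cong e′)
    ∂-cong (⊕-cong e e′)    = ⊕-cong (∂-cong e) (∂-cong e′)
    ∂-cong (⊗-cong e e′)    = ⊕-cong (⊗-cong (∂-cong e) e′) (⊗-cong e (∂-cong e′))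
    ∂-cong (⊕-assoc p q r)  = ⊕-assoc _ _ _
    ∂-cong (⊕-comm p q)     = ⊕-comm _ _
    ∂-cong (⊕-idˡ p)        = ⊕-idˡ _
    ∂-cong (⊕-invʳ p)       =
      ≋-trans (⊕-cong ≋-refl (≋-trans (⊕-cong (⊗-zeroˡ p) ≋-refl) (⊕-idˡ _))) (⊕-invʳ (∂ p))
    ∂-cong (⊗-assoc p q r)  =
      solve 6 (λ p q r p′ q′ r′ → (((p′ :* q) :+ (p :* q′)) :* r) :+ ((p :* q) :* r′)
                                  := (p′ :* (q :* r)) :+ (p :* ((q′ :* r) :+ (q :* r′))))
        ≋-refl p q r (∂ p) (∂ q) (∂ r)
    ∂-cong (⊗-comm p q)     =
      solve 4 (λ p q p′ q′ → (p′ :* q) :+ (p :* q′) := (q′ :* p) :+ (q :* p′)) ≋-refl p q (∂ p) (∂ q)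
    ∂-cong (⊗-idˡ p)        = ≋-trans (⊕-cong (⊗-zeroˡ p) (⊗-idˡ _)) (⊕-idˡ _)
    ∂-cong (distribˡ p q r) =
      solve 6 (λ p q r p′ q′ r′ → (p′ :* (q :+ r)) :+ (p :* (q′ :+ r′))
                                  := ((p′ :* q) :+ (p :* q′)) :+ ((p′ :* r) :+ (p :* r′)))
        ≋-refl p q r (∂ p) (∂ q) (∂ r)
    ∂-cong (con-cong _)     = ≋-refl
    ∂-cong (con-+ a b)      = ⊕-idˡ _
    ∂-cong (con-* a b)      = ≋-trans (⊕-cong (⊗-zeroˡ _) (⊗-zeroʳ _)) (⊕-idˡ _)

    ∂-var-self : ∂ (var x) ≡ 1ₚ
    ∂-var-self = ≡.cong (if_then 1ₚ else 0ₚ) (dec-true (x ≟ x) refl)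

    ∂-toPol-zero : (e : Entry V) → e ≢ inj₁ x → ∂ (toPol e) ≋ 0ₚ
    ∂-toPol-zero (inj₁ y) y≢x = ≡⇒≋ (≡.cong (if_then 1ₚ else 0ₚ) (dec-false (y ≟ x) (y≢x ∘ ≡.cong inj₁)))
    ∂-toPol-zero (inj₂ _) _   = ≋-refl

    ∂-⊗-zero : {p q : Pol V} → ∂ p ≋ 0ₚ → ∂ q ≋ 0ₚ → ∂ (p ⊗ q) ≋ 0ₚ
    ∂-⊗-zero ∂p≋0 ∂q≋0 = ≋-trans (⊕-cong (≋-trans (⊗-cong ∂p≋0 ≋-refl) (⊗-zeroˡ _))
                                          (≋-trans (⊗-cong ≋-refl ∂q≋0) (⊗-zeroʳ _)))
                                 (⊕-idˡ _)

    ∂-Σ-zero : (f : A → Pol V) → (∀ a → ∂ (f a) ≋ 0ₚ) → ∀ as → ∂ Σ[ map f as ] ≋ 0ₚ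
    ∂-Σ-zero f ∂f≋0 []       = ≋-refl
    ∂-Σ-zero f ∂f≋0 (a ∷ as) = ≋-trans (⊕-cong (∂f≋0 a) (∂-Σ-zero f ∂f≋0 as)) (⊕-idˡ _)

    ∂-Π-zero : (f : A → Pol V) → (∀ a → ∂ (f a) ≋ 0ₚ) → ∀ as → ∂ Π[ map f as ] ≋ 0ₚ
    ∂-Π-zero f ∂f≋0 []       = ≋-refl
    ∂-Π-zero f ∂f≋0 (a ∷ as) = ∂-⊗-zero (∂f≋0 a) (∂-Π-zero f ∂f≋0 as)

    ∂-det-zero : (M : Matrix (Pol V) k) → (∀ i j → ∂ (M i j) ≋ 0ₚ) → ∂ (det M) ≋ 0ₚ
    ∂-det-zero {k = k} M ∂M≋0 =
      ∂-Σ-zero _ (λ σ → ∂-⊗-zero ≋-refl (∂-Π-zero _ (λ i → ∂M≋0 i (σ i)) (allFin k))) (perms k)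

    ∂-sub-zero : {W : Set w} (θ : W → Entry V) → (∀ y → ∂ (toPol (θ y)) ≋ 0ₚ) → ∀ p → ∂ (sub θ p) ≋ 0ₚ
    ∂-sub-zero θ ∂θ≋0 (var y) = ∂θ≋0 y
    ∂-sub-zero θ ∂θ≋0 (con a) = ≋-refl
    ∂-sub-zero θ ∂θ≋0 (p ⊕ q) = ≋-trans (⊕-cong (∂-sub-zero θ ∂θ≋0 p) (∂-sub-zero θ ∂θ≋0 q)) (⊕-idˡ _)
    ∂-sub-zero θ ∂θ≋0 (p ⊗ q) = ∂-⊗-zero (∂-sub-zero θ ∂θ≋0 p) (∂-sub-zero θ ∂θ≋0 q)

    ∂-affine : (q r : Pol V) → ∂ q ≋ 0ₚ → ∂ r ≋ 0ₚ → ∂ (var x ⊗ q ⊕ r) ≋ q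
    ∂-affine q r ∂q≋0 ∂r≋0 = begin
      (∂ (var x) ⊗ q ⊕ var x ⊗ ∂ q) ⊕ ∂ r
        ≈⟨ ⊕-cong (⊕-cong (⊗-cong (≡⇒≋ ∂-var-self) ≋-refl) (⊗-cong ≋-refl ∂q≋0)) ∂r≋0 ⟩
      (1ₚ ⊗ q ⊕ var x ⊗ 0ₚ) ⊕ 0ₚ           ≈⟨ ⊕-idʳ _ ⟩
      1ₚ ⊗ q ⊕ var x ⊗ 0ₚ                  ≈⟨ ⊕-cong (⊗-idˡ q) (⊗-zeroʳ _) ⟩
      q ⊕ 0ₚ                               ≈⟨ ⊕-idʳ q ⟩
      q                                    ∎
      where open ≋-Reasoning

    isVar? : (e : Entry V) → Dec (e ≡ inj₁ x)
    isVar? (inj₁ y) with y ≟ x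
    ... | yes refl = yes refl
    ... | no  y≢x  = no λ { refl → y≢x refl }
    isVar? (inj₂ _) = no λ ()

    module RowExpansion {k} (M : Matrix (Entry V) k) (i j : Fin k) where
      unitRow : Matrix (Entry V) k
      unitRow r c with r Fin.≟ i | c Fin.≟ j
      ... | yes _ | yes _ = inj₂ F.1#
      ... | yes _ | no _  = inj₂ F.0#
      ... | no _  | _     = M r c

      clearEntry : Matrix (Entry V) k
      clearEntry r c with r Fin.≟ i | c Fin.≟ j
      ... | yes _ | yes _ = inj₂ F.0#
      ... | yes _ | no _  = M r c
      ... | no _  | _     = M r c

      unitRow-var : ∀ r c {y} → unitRow r c ≡ inj₁ y → M r c ≡ inj₁ y
      unitRow-var r c with r Fin.≟ i | c Fin.≟ j
      ... | yes _ | yes _ = λ ()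
      ... | yes _ | no _  = λ ()
      ... | no _  | _     = id

      unitRow-readOnce : ReadOnce M → ReadOnce unitRow
      unitRow-readOnce readOnce y r c r′ c′ e e′ =
        readOnce y r c r′ c′ (unitRow-var r c e) (unitRow-var r′ c′ e′)

      module _ (readOnce : ReadOnce M) (Mij≡x : M i j ≡ inj₁ x) where
        x∉outside : ∀ {r c} → ¬ (r ≡ i × c ≡ j) → M r c ≢ inj₁ x
        x∉outside {r} {c} not-ij Mrc≡x = not-ij (readOnce x r c i j Mrc≡x Mij≡x)

        row-split : ∀ c → toPol (M i c) ≋ var x ⊗ toPol (unitRow i c) ⊕ toPol (clearEntry i c)
        row-split c with i Fin.≟ i | c Fin.≟ j
        ... | yes _   | yes refl rewrite Mij≡x = ≋-sym (≋-trans (⊕-idʳ _) (⊗-idʳ _))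
        ... | yes _   | no _     = ≋-sym (≋-trans (⊕-cong (⊗-zeroʳ _) ≋-refl) (⊕-idˡ _))
        ... | no  i≢i | _        = ⊥-elim (i≢i refl)

        rows-agree : ∀ r → r ≢ i → ∀ c →
          toPol (unitRow r c) ≋ toPol (M r c) × toPol (clearEntry r c) ≋ toPol (M r c)
        rows-agree r r≢i c with r Fin.≟ i
        ... | yes r≡i = ⊥-elim (r≢i r≡i)
        ... | no _    = ≋-refl , ≋-refl

        ∂-unitRow-zero : ∀ r c → ∂ (toPol (unitRow r c)) ≋ 0ₚ
        ∂-unitRow-zero r c with r Fin.≟ i | c Fin.≟ j
        ... | yes _   | yes _ = ≋-refl
        ... | yes _   | no _  = ≋-refl
        ... | no  r≢i | _     = ∂-toPol-zero (M r c) (x∉outside (r≢i ∘ proj₁))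

        ∂-clearEntry-zero : ∀ r c → ∂ (toPol (clearEntry r c)) ≋ 0ₚ
        ∂-clearEntry-zero r c with r Fin.≟ i | c Fin.≟ j
        ... | yes _   | yes _ = ≋-refl
        ... | yes _   | no c≢j = ∂-toPol-zero (M r c) (x∉outside (c≢j ∘ proj₂))
        ... | no  r≢i | _      = ∂-toPol-zero (M r c) (x∉outside (r≢i ∘ proj₁))

        ∂-det-unitRow : ∂ (det (polMatrix M)) ≋ det (polMatrix unitRow)
        ∂-det-unitRow =
          ≋-trans (∂-cong (det-linear-row (var x) (polMatrix M) (polMatrix unitRow) (polMatrix clearEntry) i
                                          row-split rows-agree))
                  (∂-affine (det (polMatrix unitRow)) (det (polMatrix clearEntry))
                            (∂-det-zero (polMatrix unitRow) ∂-unitRow-zero)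
                            (∂-det-zero (polMatrix clearEntry) ∂-clearEntry-zero))

    ROD-∂ : {f : Pol V} → ROD f → ROD (∂ f)
    ROD-∂ (k , M , readOnce , det≋f) = ROD-resp-≋ (∂-cong det≋f) ROD-∂det
      where
      ROD-∂det : ROD (∂ (det (polMatrix M)))
      ROD-∂det with Finₚ.any? (λ i → Finₚ.any? (λ j → isVar? (M i j)))
      ... | yes (i , j , Mij≡x) =
        k , unitRow , unitRow-readOnce readOnce , ≋-sym (∂-det-unitRow readOnce Mij≡x)
        where open RowExpansion M i j
      ... | no x∉M =
        ROD-resp-≋ (≋-sym (∂-det-zero (polMatrix M) λ i j → ∂-toPol-zero (M i j) λ Mij≡x → x∉M (i , j , Mij≡x)))
                   ROD-0ₚ

  -- Elementary symmetric polynomials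

  raise : Pol (Fin n) → Pol (Fin (suc n))
  raise = sub (inj₁ ∘ suc)

  zeroFirst : Fin (suc n) → Entry (Fin n)
  zeroFirst zero    = inj₂ F.0#
  zeroFirst (suc i) = inj₁ i

  zeroFirst-injective : VarInjective (zeroFirst {n})
  zeroFirst-injective {x = suc _} {suc _} refl refl = refl

  sub-zeroFirst-raise : (p : Pol (Fin n)) → sub zeroFirst (raise p) ≡ p
  sub-zeroFirst-raise (var i) = refl
  sub-zeroFirst-raise (con a) = refl
  sub-zeroFirst-raise (p ⊕ q) = ≡.cong₂ _⊕_ (sub-zeroFirst-raise p) (sub-zeroFirst-raise q)
  sub-zeroFirst-raise (p ⊗ q) = ≡.cong₂ _⊗_ (sub-zeroFirst-raise p) (sub-zeroFirst-raise q)

  open module ∂₀ {n : ℕ} = Derivative {V = Fin (suc n)} Fin._≟_ zero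
    using (∂; ∂-cong; ∂-affine; ∂-sub-zero; ∂-toPol-zero; ROD-∂)

  ∂-raise : (p : Pol (Fin n)) → ∂ (raise p) ≋ 0ₚ
  ∂-raise = ∂-sub-zero (inj₁ ∘ suc) (λ i → ∂-toPol-zero (inj₁ (suc i)) λ ())

  monomial : Subset n → Pol (Fin n)
  monomial {n} A = Π[ map (λ i → if lookup A i then var i else 1ₚ) (allFin n) ]

  monomial-cons : (b : Bool) (A : Subset n) → monomial (b ∷ A) ≡ (if b then var zero else 1ₚ) ⊗ raise (monomial A)
  monomial-cons {n} b A = ≡.trans (Π-allFin-suc (λ i → if lookup (b ∷ A) i then var i else 1ₚ)) (≡.cong (_ ⊗_)
    (≡.trans (≡.cong Π[_] (Listₚ.map-cong raise-factor (allFin n))) (≡.sym (sub-Π-map (inj₁ ∘ suc) _ (allFin n)))))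
    where
    raise-factor : ∀ i → (if lookup A i then var (suc i) else 1ₚ) ≡ raise (if lookup A i then var i else 1ₚ)
    raise-factor i with lookup A i
    ... | true  = refl
    ... | false = refl

  S-pred : (n d : ℕ) → Pol (Fin n)
  S-pred n zero    = 0ₚ
  S-pred n (suc d) = S n d

  hasSize : ℕ → Subset n → Bool
  hasSize d A = does (∣ A ∣ ℕ.≟ d)

  S-suc : ∀ n d → S (suc n) d ≋ var zero ⊗ raise (S-pred n d) ⊕ raise (S n d)
  S-suc n d = begin
    S (suc n) d
      ≈⟨ Σ-map-filterᵇ (hasSize d) monomial (allSubsets (suc n)) ⟩
    Σ[ map (λ A → if hasSize d A then monomial A else 0ₚ) (allSubsets (suc n)) ]
      ≈⟨ Σ-map-concatMap _ (λ A → (outside ∷ A) ∷ (inside ∷ A) ∷ []) (allSubsets n) ⟩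
    Σ[ map extensions (allSubsets n) ]
      ≈⟨ Σ-map-linear (var zero) extensions-split (allSubsets n) ⟩
    var zero ⊗ Σ[ map (λ A → lowered (hasSize d (inside ∷ A)) A) (allSubsets n) ]
      ⊕ Σ[ map (λ A → lowered (hasSize d A) A) (allSubsets n) ]
      ≈⟨ ⊕-cong (⊗-cong ≋-refl (raise-S-pred d)) (raise-S d) ⟩
    var zero ⊗ raise (S-pred n d) ⊕ raise (S n d) ∎
    where
    open ≋-Reasoning

    extensions : Subset n → Pol (Fin (suc n))
    extensions A = Σ[ map (λ A′ → if hasSize d A′ then monomial A′ else 0ₚ) ((outside ∷ A) ∷ (inside ∷ A) ∷ []) ]

    lowered : Bool → Subset n → Pol (Fin (suc n))
    lowered b A = if b then raise (monomial A) else 0ₚ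

    pascal-split : (a b : Bool) (R : Pol (Fin (suc n))) →
      (if a then 1ₚ ⊗ R else 0ₚ) ⊕ ((if b then var zero ⊗ R else 0ₚ) ⊕ 0ₚ)
        ≋ var zero ⊗ (if b then R else 0ₚ) ⊕ (if a then R else 0ₚ)
    pascal-split true  true  R = ≋-trans (⊕-cong (⊗-idˡ R) (⊕-idʳ _)) (⊕-comm _ _)
    pascal-split true  false R =
      ≋-trans (⊕-cong (⊗-idˡ R) (⊕-idʳ _)) (≋-trans (⊕-comm _ _) (⊕-cong (≋-sym (⊗-zeroʳ _)) ≋-refl))
    pascal-split false true  R = ⊕-idˡ _
    pascal-split false false R = ≋-trans (⊕-idˡ _) (⊕-cong (≋-sym (⊗-zeroʳ _)) ≋-refl)

    extensions-split : ∀ A → extensions A ≋ var zero ⊗ lowered (hasSize d (inside ∷ A)) A ⊕ lowered (hasSize d A) A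
    extensions-split A rewrite monomial-cons outside A | monomial-cons inside A =
      pascal-split (hasSize d A) (hasSize d (inside ∷ A)) (raise (monomial A))

    raise-S : ∀ d → Σ[ map (λ A → lowered (hasSize d A) A) (allSubsets n) ] ≋ raise (S n d)
    raise-S d = ≋-sym (≋-trans (≡⇒≋ (sub-Σ-map (inj₁ ∘ suc) monomial (filterᵇ (hasSize d) (allSubsets n))))
                               (Σ-map-filterᵇ (hasSize d) (raise ∘ monomial) (allSubsets n)))

    raise-S-pred : ∀ d → Σ[ map (λ A → lowered (hasSize d (inside ∷ A)) A) (allSubsets n) ] ≋ raise (S-pred n d)
    raise-S-pred zero    = Σ-map-zero (λ _ → ≋-refl) (allSubsets n)
    raise-S-pred (suc d) = raise-S d

  S-drop : ∀ n d → sub zeroFirst (S (suc n) d) ≋ S n d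
  S-drop n d = begin
    sub zeroFirst (S (suc n) d)
      ≈⟨ sub-cong zeroFirst (S-suc n d) ⟩
    0ₚ ⊗ sub zeroFirst (raise (S-pred n d)) ⊕ sub zeroFirst (raise (S n d))
      ≡⟨ ≡.cong₂ (λ p q → 0ₚ ⊗ p ⊕ q) (sub-zeroFirst-raise _) (sub-zeroFirst-raise _) ⟩
    0ₚ ⊗ S-pred n d ⊕ S n d
      ≈⟨ ≋-trans (⊕-cong (⊗-zeroˡ _) ≋-refl) (⊕-idˡ _) ⟩
    S n d ∎
    where open ≋-Reasoning

  S-∂ : ∀ n d → sub zeroFirst (∂ (S (suc n) (suc d))) ≋ S n d
  S-∂ n d = begin
    sub zeroFirst (∂ (S (suc n) (suc d)))
      ≈⟨ sub-cong zeroFirst (∂-cong (S-suc n (suc d))) ⟩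
    sub zeroFirst (∂ (var zero ⊗ raise (S n d) ⊕ raise (S n (suc d))))
      ≈⟨ sub-cong zeroFirst (∂-affine (raise (S n d)) (raise (S n (suc d))) (∂-raise (S n d)) (∂-raise (S n (suc d)))) ⟩
    sub zeroFirst (raise (S n d))
      ≡⟨ sub-zeroFirst-raise (S n d) ⟩
    S n d ∎
    where open ≋-Reasoning

  ROD-S-drop : ∀ {n d} → ROD (S (suc n) d) → ROD (S n d)
  ROD-S-drop {n} {d} = ROD-resp-≋ (S-drop n d) ∘ ROD-sub zeroFirst zeroFirst-injective

  ROD-S-∂ : ∀ {n d} → ROD (S (suc n) (suc d)) → ROD (S n d)
  ROD-S-∂ {n} {d} = ROD-resp-≋ (S-∂ n d) ∘ ROD-sub zeroFirst zeroFirst-injective ∘ ROD-∂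

  -- Permanents

  cornerMinor : Fin (suc n) × Fin (suc n) → Entry (Fin n × Fin n)
  cornerMinor (zero  , zero)  = inj₂ F.1#
  cornerMinor (zero  , suc _) = inj₂ F.0#
  cornerMinor (suc _ , zero)  = inj₂ F.0#
  cornerMinor (suc i , suc j) = inj₁ (i , j)

  cornerMinor-var : ∀ (ij : Fin (suc n) × Fin (suc n)) {z} → cornerMinor ij ≡ inj₁ z → ij ≡ (suc (proj₁ z) , suc (proj₂ z))
  cornerMinor-var (zero  , zero)  ()
  cornerMinor-var (zero  , suc _) ()
  cornerMinor-var (suc _ , zero)  ()
  cornerMinor-var (suc i , suc j) refl = refl

  cornerMinor-injective : VarInjective (cornerMinor {n})
  cornerMinor-injective {x = ij} {kl} e e′ = ≡.trans (cornerMinor-var ij e) (≡.sym (cornerMinor-var kl e′))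

  permTerm : (Fin n → Fin n) → Pol (Fin n × Fin n)
  permTerm {n} σ = Π[ map (λ i → var (i , σ i)) (allFin n) ]

  sub-cornerMinor-permTerm : (τ : Fin n → Fin n) → sub cornerMinor (permTerm (zero ◂ (suc ∘ τ))) ≋ permTerm τ
  sub-cornerMinor-permTerm {n} τ =
    ≋-trans (≡⇒≋ (≡.trans (sub-Π-map cornerMinor _ (allFin (suc n)))
                          (Π-allFin-suc (λ i → toPol (cornerMinor (i , (zero ◂ (suc ∘ τ)) i))))))
            (⊗-idˡ _)

  injectiveStep : (Fin n → Fin n) → Fin n × Fin n → Bool → Bool
  injectiveStep σ ij b = not (does (σ (proj₁ ij) Fin.≟ σ (proj₂ ij))) ∧ b

  injectiveOn : (Fin n → Fin n) → List (Fin n × Fin n) → Bool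
  injectiveOn σ = foldr (injectiveStep σ) true

  injectiveOn-cong : {σ τ : Fin n → Fin n} → σ ≗ τ → ∀ ps → injectiveOn σ ps ≡ injectiveOn τ ps
  injectiveOn-cong σ≗τ []            = refl
  injectiveOn-cong σ≗τ ((i , j) ∷ ps) =
    ≡.cong₂ _∧_ (≡.cong₂ (λ u v → not (does (u Fin.≟ v))) (σ≗τ i) (σ≗τ j)) (injectiveOn-cong σ≗τ ps)

  isPerm-cong : {σ τ : Fin n → Fin n} → σ ≗ τ → isPerm σ ≡ isPerm τ
  isPerm-cong {n} σ≗τ = injectiveOn-cong σ≗τ (pairs n)

  suc×suc : Fin n × Fin n → Fin (suc n) × Fin (suc n)
  suc×suc (i , j) = suc i , suc j

  pairs-suc : ∀ n → pairs (suc n) ≡ map (λ j → zero , suc j) (allFin n) ++ map suc×suc (pairs n)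
  pairs-suc n = ≡.trans (concatMap-allFin-suc (row {suc n}))
    (≡.cong₂ _++_ (≡.trans (concatMap-allFin-suc (rowStep zero)) (concatMap-singleton _ (allFin n)))
                  (≡.trans (Listₚ.concatMap-cong row-suc (allFin n)) (≡.sym (Listₚ.map-concatMap suc×suc row (allFin n)))))
    where
    rowStep : ∀ {k} → Fin k → Fin k → List (Fin k × Fin k)
    rowStep i j = if does (i Fin.<? j) then [ (i , j) ] else []

    row : ∀ {k} → Fin k → List (Fin k × Fin k)
    row {k} i = concatMap (rowStep i) (allFin k)

    map-suc×suc-if : (b : Bool) (i j : Fin n) → map suc×suc (if b then [ (i , j) ] else []) ≡ (if b then [ (suc i , suc j) ] else [])
    map-suc×suc-if true  i j = refl
    map-suc×suc-if false i j = refl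

    row-suc : (i : Fin n) → row (suc i) ≡ map suc×suc (row i)
    row-suc i = ≡.trans (concatMap-allFin-suc (rowStep (suc i)))
      (≡.trans (≡.sym (Listₚ.concatMap-cong (λ j → map-suc×suc-if (does (i Fin.<? j)) i j) (allFin n)))
               (≡.sym (Listₚ.map-concatMap suc×suc _ (allFin n))))

  isPerm-zero◂suc : (τ : Fin n → Fin n) → isPerm (zero ◂ (suc ∘ τ)) ≡ isPerm τ
  isPerm-zero◂suc {n} τ = begin
    injectiveOn σ (pairs (suc n))
      ≡⟨ ≡.cong (injectiveOn σ) (pairs-suc n) ⟩
    injectiveOn σ (firstRow ++ map suc×suc (pairs n))
      ≡⟨ Listₚ.foldr-++ _ true firstRow _ ⟩
    foldr _ (injectiveOn σ (map suc×suc (pairs n))) firstRow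
      ≡⟨ firstRow-injective _ (allFin n) ⟩
    injectiveOn σ (map suc×suc (pairs n))
      ≡⟨ injectiveOn-suc×suc (pairs n) ⟩
    injectiveOn τ (pairs n) ∎
    where
    open ≡.≡-Reasoning
    σ = zero ◂ (suc ∘ τ)
    firstRow = map (λ j → zero , suc j) (allFin n)

    firstRow-injective : ∀ b js → foldr (injectiveStep σ) b (map (λ j → zero , suc j) js) ≡ b
    firstRow-injective b []       = refl
    firstRow-injective b (j ∷ js) = firstRow-injective b js

    injectiveOn-suc×suc : ∀ ps → injectiveOn σ (map suc×suc ps) ≡ injectiveOn τ ps
    injectiveOn-suc×suc []            = refl
    injectiveOn-suc×suc ((i , j) ∷ ps) = ≡.cong (not (does (τ i Fin.≟ τ j)) ∧_) (injectiveOn-suc×suc ps)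

  module _ {w} {W : Set w} where
    open ≋-Reasoning

    Σ-allFuns-suc : (f : (Fin (suc m) → Fin N) → Pol W) → (∀ {σ τ} → σ ≗ τ → f σ ≡ f τ) →
      Σ[ map f (allFuns (suc m) N) ] ≋ Σ[ map (λ τ → Σ[ map (λ a → f (a ◂ τ)) (allFin N) ]) (allFuns m N) ]
    Σ-allFuns-suc {m} {N} f f-ext =
      ≋-trans (Σ-map-concatMap f _ (allFuns m N))
              (Σ-map-cong (λ τ → inner τ _ λ a → λ { zero → refl ; (suc i) → refl }) (allFuns m N))
      where
      inner : ∀ τ (g : Fin N → Fin (suc m) → Fin N) → (∀ a → g a ≗ a ◂ τ) →
        Σ[ map f (map g (allFin N)) ] ≋ Σ[ map (λ a → f (a ◂ τ)) (allFin N) ]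
      inner τ g g≗◂ = ≡⇒≋ (≡.cong Σ[_] (≡.trans (≡.sym (Listₚ.map-∘ (allFin N)))
                                                (Listₚ.map-cong (f-ext ∘ g≗◂) (allFin N))))

    Σ-allFuns-avoiding-zero : (f : (Fin m → Fin (suc N)) → Pol W) → (∀ {σ τ} → σ ≗ τ → f σ ≡ f τ) →
      (∀ σ i → σ i ≡ zero → f σ ≋ 0ₚ) →
      Σ[ map f (allFuns m (suc N)) ] ≋ Σ[ map (λ τ → f (suc ∘ τ)) (allFuns m N) ]
    Σ-allFuns-avoiding-zero {zero}  f f-ext f-zero = ⊕-cong (≡⇒≋ (f-ext λ ())) ≋-refl
    Σ-allFuns-avoiding-zero {suc m} {N} f f-ext f-zero = begin
      Σ[ map f (allFuns (suc m) (suc N)) ]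
        ≈⟨ Σ-allFuns-suc f f-ext ⟩
      Σ[ map f′ (allFuns m (suc N)) ]
        ≈⟨ Σ-allFuns-avoiding-zero f′ f′-ext f′-zero ⟩
      Σ[ map (λ τ → f′ (suc ∘ τ)) (allFuns m N) ]
        ≈⟨ Σ-map-cong drop-zero (allFuns m N) ⟩
      Σ[ map (λ τ → Σ[ map (λ a → f (suc ∘ (a ◂ τ))) (allFin N) ]) (allFuns m N) ]
        ≈⟨ Σ-allFuns-suc (λ σ → f (suc ∘ σ)) (λ σ≗τ → f-ext (≡.cong suc ∘ σ≗τ)) ⟨
      Σ[ map (λ σ → f (suc ∘ σ)) (allFuns (suc m) N) ] ∎
      where
      f′ : (Fin m → Fin (suc N)) → Pol W
      f′ τ = Σ[ map (λ a → f (a ◂ τ)) (allFin (suc N)) ]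

      f′-ext : ∀ {σ τ} → σ ≗ τ → f′ σ ≡ f′ τ
      f′-ext σ≗τ = ≡.cong Σ[_] (Listₚ.map-cong (λ a → f-ext λ { zero → refl ; (suc i) → σ≗τ i }) (allFin (suc N)))

      f′-zero : ∀ τ i → τ i ≡ zero → f′ τ ≋ 0ₚ
      f′-zero τ i τi≡0 = Σ-map-zero (λ a → f-zero (a ◂ τ) (suc i) τi≡0) (allFin (suc N))

      drop-zero : ∀ τ → f′ (suc ∘ τ) ≋ Σ[ map (λ a → f (suc ∘ (a ◂ τ))) (allFin N) ]
      drop-zero τ = begin
        f′ (suc ∘ τ)
          ≡⟨ ≡.cong Σ[_] (map-allFin-suc (λ a → f (a ◂ (suc ∘ τ)))) ⟩
        f (zero ◂ (suc ∘ τ)) ⊕ Σ[ map (λ a → f (suc a ◂ (suc ∘ τ))) (allFin N) ]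
          ≈⟨ ≋-trans (⊕-cong (f-zero _ zero refl) ≋-refl) (⊕-idˡ _) ⟩
        Σ[ map (λ a → f (suc a ◂ (suc ∘ τ))) (allFin N) ]
          ≡⟨ ≡.cong Σ[_] (Listₚ.map-cong (λ a → f-ext λ { zero → refl ; (suc i) → refl }) (allFin N)) ⟩
        Σ[ map (λ a → f (suc ∘ (a ◂ τ))) (allFin N) ] ∎

  Perm-cornerMinor : ∀ n → sub cornerMinor (Perm (suc n)) ≋ Perm n
  Perm-cornerMinor n = begin
    sub cornerMinor (Perm (suc n))
      ≡⟨ sub-Σ-map cornerMinor permTerm (perms (suc n)) ⟩
    Σ[ map (sub cornerMinor ∘ permTerm) (filterᵇ isPerm (allFuns (suc n) (suc n))) ]
      ≈⟨ Σ-map-filterᵇ isPerm (sub cornerMinor ∘ permTerm) (allFuns (suc n) (suc n)) ⟩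
    Σ[ map t (allFuns (suc n) (suc n)) ]
      ≈⟨ Σ-allFuns-suc t t-ext ⟩
    Σ[ map (λ τ → Σ[ map (λ a → t (a ◂ τ)) (allFin (suc n)) ]) (allFuns n (suc n)) ]
      ≈⟨ Σ-map-cong first-row (allFuns n (suc n)) ⟩
    Σ[ map (λ τ → t (zero ◂ τ)) (allFuns n (suc n)) ]
      ≈⟨ Σ-allFuns-avoiding-zero (λ τ → t (zero ◂ τ)) (λ σ≗τ → t-ext λ { zero → refl ; (suc i) → σ≗τ i })
                                 first-column ⟩
    Σ[ map (λ τ → t (zero ◂ (suc ∘ τ))) (allFuns n n) ]
      ≈⟨ Σ-map-cong minor (allFuns n n) ⟩
    Σ[ map (λ τ → if isPerm τ then permTerm τ else 0ₚ) (allFuns n n) ]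
      ≈⟨ Σ-map-filterᵇ isPerm permTerm (allFuns n n) ⟨
    Perm n ∎
    where
    open ≋-Reasoning

    t : (Fin (suc n) → Fin (suc n)) → Pol (Fin n × Fin n)
    t σ = if isPerm σ then sub cornerMinor (permTerm σ) else 0ₚ

    t-ext : ∀ {σ τ} → σ ≗ τ → t σ ≡ t τ
    t-ext σ≗τ = ≡.cong₂ (λ b p → if b then p else 0ₚ) (isPerm-cong σ≗τ)
      (≡.cong (sub cornerMinor ∘ Π[_]) (Listₚ.map-cong (λ i → ≡.cong (λ j → var (i , j)) (σ≗τ i)) (allFin (suc n))))

    t-zero : ∀ σ i → cornerMinor (i , σ i) ≡ inj₂ F.0# → t σ ≋ 0ₚ
    t-zero σ i entry≡0 = if-zero (isPerm σ)
      (≋-trans (≡⇒≋ (sub-Π-map cornerMinor _ (allFin (suc n)))) (Π-allFin-zero _ i (≡⇒≋ (≡.cong toPol entry≡0))))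

    first-row : ∀ τ → Σ[ map (λ a → t (a ◂ τ)) (allFin (suc n)) ] ≋ t (zero ◂ τ)
    first-row τ = ≋-trans (≡⇒≋ (≡.cong Σ[_] (map-allFin-suc (λ a → t (a ◂ τ)))))
      (≋-trans (⊕-cong ≋-refl (Σ-map-zero (λ a → t-zero (suc a ◂ τ) zero refl) (allFin n))) (⊕-idʳ _))

    first-column : ∀ τ i → τ i ≡ zero → t (zero ◂ τ) ≋ 0ₚ
    first-column τ i τi≡0 = t-zero (zero ◂ τ) (suc i) (≡.cong (λ j → cornerMinor (suc i , j)) τi≡0)

    minor : ∀ τ → t (zero ◂ (suc ∘ τ)) ≋ (if isPerm τ then permTerm τ else 0ₚ)
    minor τ = ≋-trans (≡⇒≋ (≡.cong (λ b → if b then sub cornerMinor (permTerm (zero ◂ (suc ∘ τ))) else 0ₚ)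
                                   (isPerm-zero◂suc τ)))
                      (if-cong (isPerm τ) (sub-cornerMinor-permTerm τ))

  ROD-Perm-suc : ∀ {n} → ROD (Perm (suc n)) → ROD (Perm n)
  ROD-Perm-suc {n} = ROD-resp-≋ (Perm-cornerMinor n) ∘ ROD-sub cornerMinor cornerMinor-injective

  ROD-S-≤′ : ∀ {m n d} → m ≤′ n → ROD (S n d) → ROD (S m d)
  ROD-S-≤′ ≤′-refl        = id
  ROD-S-≤′ (≤′-step m≤′n) = ROD-S-≤′ m≤′n ∘ ROD-S-drop

  ROD-S-∂ⁿ : ∀ e {n d} → ROD (S (e + n) (e + d)) → ROD (S n d)
  ROD-S-∂ⁿ zero    = id
  ROD-S-∂ⁿ (suc e) = ROD-S-∂ⁿ e ∘ ROD-S-∂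

  ROD-S-minor : ∀ {m n k d} → k ≤ d → m + (d ∸ k) ≤ n → ROD (S n d) → ROD (S m k)
  ROD-S-minor {m} {n} {k} {d} k≤d m+e≤n =
    ROD-S-∂ⁿ e ∘ ≡.subst (λ d′ → ROD (S (e + m) d′)) (≡.sym (ℕₚ.m∸n+n≡m k≤d))
               ∘ ROD-S-≤′ (ℕₚ.≤⇒≤′ e+m≤n)
    where
    e = d ∸ k
    e+m≤n : e + m ≤ n
    e+m≤n = ≡.subst (_≤ n) (ℕₚ.+-comm m e) m+e≤n

  ROD-Perm-≤′ : ∀ {m n} → m ≤′ n → ROD (Perm n) → ROD (Perm m)
  ROD-Perm-≤′ ≤′-refl        = id
  ROD-Perm-≤′ (≤′-step m≤′n) = ROD-Perm-≤′ m≤′n ∘ ROD-Perm-suc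

lemma3 : ∀ {c ℓ} (F : Field c ℓ) → let open Poly F in
    (∀ m k → ¬ ROD (S m k) → ∀ n d → k ≤ d → m + (d ∸ k) ≤ n → ¬ ROD (S n d))
    × (∀ m → ¬ ROD (Perm m) → ∀ n → m ≤ n → ¬ ROD (Perm n))
lemma3 F =
  (λ m k S-not-ROD n d k≤d m+e≤n → S-not-ROD ∘ ROD-S-minor F k≤d m+e≤n) ,
  (λ m Perm-not-ROD n m≤n → Perm-not-ROD ∘ ROD-Perm-≤′ F (ℕₚ.≤⇒≤′ m≤n))
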